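{- Let $1\le k\le n$. The number of $k$-shift-invariant functions $G\colon\mathbb{F}_2^n\to\mathbb{F}_2^n$ that are affine equivalent to the identity map $I$ of $\mathbb{F}_2^n$ is two times the number of invertible $k$-circulant $n\times n$ matrices over $\mathbb{F}_2$.
   Context: $S$ is the right cyclic shift on $\mathbb{F}_2^n$, $S(x_1,\dotsc,x_n)=(x_n,x_1,\dotsc,x_{n-1})$. $G$ is $k$-shift-invariant if $G\circ S=S^k\circ G$. $G$ is affine equivalent to $I$ if there exist invertible matrices $A,B$ over $\mathbb{F}_2$ and $d,e\in\mathbb{F}_2^n$ with $Ax+e=BG(x)+d$ for all $x$. A matrix is $k$-circulant if its $i$-th row is $S^{(i-1)k}$ applied to its first row, for $1\le i\le n$. -}

module Defs where

open import Level using (0ℓ)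
open import Data.Bool using (Bool; true; false; _xor_; _∧_)
open import Data.Nat using (ℕ; zero; suc; _*_)
open import Data.Fin using (Fin; toℕ)
open import Data.Vec using (Vec; []; _∷_; zipWith; foldr; last; init; lookup; map; replicate; tabulate)
open import Data.Product using (Σ; ∃; _×_; _,_; proj₁)
open import Relation.Binary.PropositionalEquality as P using (_≡_)
open import Relation.Binary.Bundles using (Setoid)
open import Function.Bundles using (Inverse)
open import Data.Fin using (_≟_)
open import Relation.Nullary using (does)

-- F₂ is Bool with xor as addition and ∧ as multiplication.
-- Vectors of 𝔽₂ⁿ
V : ℕ → Set
V n = Vec Bool n

_⊕_ : ∀ {n} → V n → V n → V n
_⊕_ = zipWith _xor_

dot : ∀ {n} → V n → V n → Bool
dot x y = foldr (λ _ → Bool) _xor_ false (zipWith _∧_ x y)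

-- n×n matrices over 𝔽₂, given as the vector of their rows
Mat : ℕ → Set
Mat n = Vec (V n) n

_·_ : ∀ {n} → Mat n → V n → V n
A · x = map (λ row → dot row x) A

transpose : ∀ {n} → Mat n → Mat n
transpose {n} A = tabulate (λ j → map (λ row → lookup row j) A)

_⊗_ : ∀ {n} → Mat n → Mat n → Mat n
A ⊗ B = map (λ row → map (λ col → dot row col) (transpose B)) A

idMat : ∀ {n} → Mat n
idMat = tabulate (λ i → tabulate (λ j → does (i ≟ j)))

Invertible : ∀ {n} → Mat n → Set
Invertible A = ∃ λ B → (A ⊗ B ≡ idMat) × (B ⊗ A ≡ idMat)

S : ∀ {n} → V n → V n
S {zero} [] = []
S {suc n} v = last v ∷ init v

Sʳ : ∀ {n} → ℕ → V n → V n
Sʳ zero x = x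
Sʳ (suc m) x = S (Sʳ m x)

ShiftInvariant : ∀ {n} → ℕ → (V n → V n) → Set
ShiftInvariant k G = ∀ x → G (S x) ≡ Sʳ k (G x)

AffEqId : ∀ {n} → (V n → V n) → Set
AffEqId {n} G = Σ (Mat n) λ A → Σ (Mat n) λ B → Σ (V n) λ d → Σ (V n) λ e →
  Invertible A × Invertible B × (∀ x → (A · x) ⊕ e ≡ (B · G x) ⊕ d)

-- k-circulant: the i-th row (i = 0,…,n-1 here) is S^{ik} applied to the first row
-- (r is necessarily the first row, taking i = 0)
Circulant : ∀ {n} → ℕ → Mat n → Set
Circulant {n} k M = Σ (V n) λ r → ∀ (i : Fin n) → lookup M i ≡ Sʳ (toℕ i * k) r

ShiftInvAffIdSetoid : ℕ → ℕ → Setoid 0ℓ 0ℓ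
ShiftInvAffIdSetoid n k = record
  { Carrier = Σ (V n → V n) (λ G → ShiftInvariant k G × AffEqId G)
  ; _≈_ = λ G H → ∀ x → proj₁ G x ≡ proj₁ H x
  ; isEquivalence = record
    { refl = λ x → P.refl
    ; sym = λ p x → P.sym (p x)
    ; trans = λ p q x → P.trans (p x) (q x) } }

InvCircSetoid : ℕ → ℕ → Setoid 0ℓ 0ℓ
InvCircSetoid n k = record
  { Carrier = Σ (Mat n) (λ M → Invertible M × Circulant k M)
  ; _≈_ = λ M N → proj₁ M ≡ proj₁ N
  ; isEquivalence = record
    { refl = P.refl ; sym = P.sym ; trans = P.trans } }

HasCard : Setoid 0ℓ 0ℓ → ℕ → Set
HasCard X N = Inverse X (P.setoid (Fin N))

{-# OPTIONS --safe #-}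
module Submission where

-- If G is affine equivalent to I then G x = L x + c with L invertible.  Shift invariance on the
-- basis, G (e_{j+1}) = G (S e_j) = S^k G (e_j), says that the matrix M = Lᵀ, whose j-th row is
-- G (e_j) + G 0, is k-circulant; conversely x ↦ Mᵀ x + c is k-shift-invariant whenever M is
-- k-circulant and S^k c = c.  Rows of an invertible matrix are distinct, while in a k-circulant
-- matrix row n/d equals row 0 for every common divisor d of k and n, so gcd (k, n) = 1.  Then
-- S^k c = c forces S c = c, i.e. c is 0 or (1, …, 1).  Hence G ↦ (c, M) is a bijection onto
-- {0, 1} × {invertible k-circulant matrices}.

open import Defs
open import Level using (0ℓ)
open import Algebra.Bundles using (CommutativeRing)
open import Data.Bool using (Bool; true; false; _xor_; _∧_)
import Data.Bool as Bool
open import Data.Bool.Properties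
  using (xor-assoc; xor-identityˡ; xor-identityʳ; xor-same; ∧-comm; ∧-assoc; ∧-zeroʳ; ∧-identityʳ;
         ∧-distribˡ-xor; xor-∧-commutativeRing)
open import Data.Empty using (⊥-elim)
open import Data.Fin using (Fin; zero; suc; toℕ; fromℕ; fromℕ<; inject₁; _≟_)
open import Data.Fin.Properties
  using (toℕ-injective; toℕ-fromℕ; toℕ-fromℕ<; toℕ-inject₁; toℕ≤pred[n]; fromℕ≢inject₁; inject₁-injective;
         suc-injective; 2↔Bool; +↔⊎; *↔×)
open import Data.Nat using (ℕ; zero; suc; _+_; _*_; _∸_; _≤_; _<_; s≤s; z≤n)
import Data.Nat.Properties as ℕ
open import Data.Nat.Properties
  using (1+n≢0; +-suc; +-identityʳ; *-comm; *-zeroʳ; m+[n∸m]≡n; m<m*n; *-commutativeSemigroup)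
open import Data.Nat.Divisibility using (divides)
open import Data.Nat.Coprimality using (Coprime; coprime-Bézout)
open import Data.Nat.GCD using (module Bézout)
open import Data.Product using (Σ; ∃; _×_; _,_; proj₁; proj₂)
open import Data.Product.Function.NonDependent.Setoid using (_×-inverse_)
open import Data.Product.Relation.Binary.Pointwise.NonDependent using (_×ₛ_)
import Data.Product.Relation.Binary.Pointwise.NonDependent as ×ᴾ
open import Data.Sum using (_⊎_; inj₁; inj₂)
open import Data.Sum.Function.Setoid using (_⊎-inverse_)
open import Data.Sum.Relation.Binary.Pointwise using (_⊎ₛ_)
import Data.Sum.Relation.Binary.Pointwise as ⊎ᴾ
open import Data.Vec using (Vec; []; _∷_; lookup; map; replicate; tabulate; init; last; initLast; _∷ʳ_)
open import Data.Vec.Properties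
  using (lookup-map; lookup-zipWith; lookup-replicate; lookup∘tabulate; tabulate∘lookup; tabulate-cong; ≡-dec;
         zipWith-assoc; zipWith-identityˡ; zipWith-identityʳ)
open import Function using (_∘_)
open import Function.Bundles using (Inverse; _⇔_; mk⇔)
open import Function.Consequences.Setoid using (strictlyInverseˡ⇒inverseˡ; strictlyInverseʳ⇒inverseʳ)
import Function.Properties.Inverse as Inv
open import Relation.Binary.Bundles using (Setoid)
import Relation.Binary.Construct.On as On
open import Relation.Binary.PropositionalEquality
import Relation.Binary.PropositionalEquality as ≡
open import Relation.Nullary using (Dec; does; yes; no)
open import Relation.Nullary.Decidable using (does-⇔; dec-true; map′; _×-dec_; _⊎-dec_)

open import Algebra.Properties.CommutativeSemigroup *-commutativeSemigroup using (x∙yz≈y∙xz)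
open import Algebra.Properties.Semiring.Sum (CommutativeRing.semiring xor-∧-commutativeRing)
  using (sum; sum-cong-≗; sum-replicate-zero; ∑-comm; ∑-distrib-+; *-distribˡ-sum; *-distribʳ-sum)

open ≡-Reasoning

private
  variable
    m n : ℕ

strictInverse : ∀ {a b ℓ₁ ℓ₂} {S : Setoid a ℓ₁} {T : Setoid b ℓ₂} →
                let open Setoid S using () renaming (_≈_ to _≈₁_); open Setoid T using () renaming (_≈_ to _≈₂_) in
                (to : Setoid.Carrier S → Setoid.Carrier T) (from : Setoid.Carrier T → Setoid.Carrier S) →
                (∀ {x y} → x ≈₁ y → to x ≈₂ to y) → (∀ {x y} → x ≈₂ y → from x ≈₁ from y) →
                (∀ y → to (from y) ≈₂ y) → (∀ x → from (to x) ≈₁ x) → Inverse S T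
strictInverse {S = S} {T} to from to-cong from-cong to∘from from∘to = record
  { to        = to
  ; from      = from
  ; to-cong   = to-cong
  ; from-cong = from-cong
  ; inverse   = strictlyInverseˡ⇒inverseˡ S T to-cong to∘from , strictlyInverseʳ⇒inverseʳ S T from-cong from∘to
  }

-- Matrices over 𝔽₂

vec-ext : ∀ {A : Set} {u v : Vec A n} → (∀ i → lookup u i ≡ lookup v i) → u ≡ v
vec-ext {u = u} {v} p = trans (sym (tabulate∘lookup u)) (trans (tabulate-cong p) (tabulate∘lookup v))

entry : Mat n → Fin n → Fin n → Bool
entry A i j = lookup (lookup A i) j

mat-ext : {A B : Mat n} → (∀ i j → entry A i j ≡ entry B i j) → A ≡ B
mat-ext p = vec-ext (λ i → vec-ext (p i))

zeroV : V n
zeroV = replicate _ false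

unit : Fin n → V n
unit j = tabulate (λ l → does (j ≟ l))

lookup-unit : (j i : Fin n) → lookup (unit j) i ≡ does (j ≟ i)
lookup-unit j = lookup∘tabulate _

does-sym : (i j : Fin n) → does (i ≟ j) ≡ does (j ≟ i)
does-sym i j = does-⇔ (mk⇔ sym sym) (i ≟ j) (j ≟ i)

sum-δ : ∀ {n} (f : Fin n → Bool) (j : Fin n) → sum (λ l → f l ∧ does (j ≟ l)) ≡ f j
sum-δ {suc n} f zero = begin
  (f zero ∧ true) xor sum (λ l → f (suc l) ∧ false)
    ≡⟨ cong₂ _xor_ (∧-identityʳ (f zero)) (sum-cong-≗ (λ l → ∧-zeroʳ (f (suc l)))) ⟩
  f zero xor sum {n} (λ _ → false)        ≡⟨ cong (f zero xor_) (sum-replicate-zero n) ⟩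
  f zero xor false                      ≡⟨ xor-identityʳ (f zero) ⟩
  f zero                                ∎
sum-δ f (suc j) = begin
  (f zero ∧ false) xor sum (λ l → f (suc l) ∧ does (j ≟ l))
    ≡⟨ cong (_xor sum (λ l → f (suc l) ∧ does (j ≟ l))) (∧-zeroʳ (f zero)) ⟩
  sum (λ l → f (suc l) ∧ does (j ≟ l))  ≡⟨ sum-δ (f ∘ suc) j ⟩
  f (suc j)                             ∎

dot-sum : (x y : V n) → dot x y ≡ sum (λ l → lookup x l ∧ lookup y l)
dot-sum []      []      = refl
dot-sum (a ∷ x) (b ∷ y) = cong ((a ∧ b) xor_) (dot-sum x y)

lookup-· : (A : Mat n) (x : V n) (i : Fin n) → lookup (A · x) i ≡ sum (λ l → entry A i l ∧ lookup x l)
lookup-· A x i = trans (lookup-map i (λ row → dot row x) A) (dot-sum (lookup A i) x)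

entry-transpose : (A : Mat n) (i j : Fin n) → entry (transpose A) i j ≡ entry A j i
entry-transpose A i j = trans (cong (λ v → lookup v j) (lookup∘tabulate _ i)) (lookup-map j _ A)

entry-⊗ : (A B : Mat n) (i j : Fin n) → entry (A ⊗ B) i j ≡ sum (λ l → entry A i l ∧ entry B l j)
entry-⊗ A B i j = begin
  lookup (lookup (A ⊗ B) i) j
    ≡⟨ cong (λ v → lookup v j) (lookup-map i _ A) ⟩
  lookup (map (dot (lookup A i)) (transpose B)) j
    ≡⟨ lookup-map j _ (transpose B) ⟩
  dot (lookup A i) (lookup (transpose B) j)
    ≡⟨ dot-sum (lookup A i) _ ⟩
  sum (λ l → entry A i l ∧ entry (transpose B) j l)
    ≡⟨ sum-cong-≗ (λ l → cong (entry A i l ∧_) (entry-transpose B j l)) ⟩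
  sum (λ l → entry A i l ∧ entry B l j)
    ∎

entry-idMat : (i j : Fin n) → entry idMat i j ≡ does (i ≟ j)
entry-idMat i j = trans (cong (λ v → lookup v j) (lookup∘tabulate _ i)) (lookup∘tabulate _ j)

transpose-involutive : (A : Mat n) → transpose (transpose A) ≡ A
transpose-involutive A = mat-ext λ i j → trans (entry-transpose _ i j) (entry-transpose A j i)

transpose-⊗ : (A B : Mat n) → transpose (A ⊗ B) ≡ transpose B ⊗ transpose A
transpose-⊗ A B = mat-ext λ i j → begin
  entry (transpose (A ⊗ B)) i j          ≡⟨ entry-transpose _ i j ⟩
  entry (A ⊗ B) j i                      ≡⟨ entry-⊗ A B j i ⟩
  sum (λ l → entry A j l ∧ entry B l i)  ≡⟨ sum-cong-≗ (λ l → trans (∧-comm (entry A j l) (entry B l i))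
                                              (sym (cong₂ _∧_ (entry-transpose B i l) (entry-transpose A l j)))) ⟩
  sum (λ l → entry (transpose B) i l ∧ entry (transpose A) l j) ≡⟨ sym (entry-⊗ (transpose B) (transpose A) i j) ⟩
  entry (transpose B ⊗ transpose A) i j  ∎

transpose-idMat : transpose (idMat {n}) ≡ idMat
transpose-idMat = mat-ext λ i j →
  trans (entry-transpose idMat i j) (trans (entry-idMat j i) (trans (does-sym j i) (sym (entry-idMat i j))))

·-assoc : (A B : Mat n) (x : V n) → (A ⊗ B) · x ≡ A · (B · x)
·-assoc A B x = vec-ext λ i → begin
  lookup ((A ⊗ B) · x) i
    ≡⟨ lookup-· (A ⊗ B) x i ⟩
  sum (λ l → entry (A ⊗ B) i l ∧ lookup x l)
    ≡⟨ sum-cong-≗ (λ l → cong (_∧ lookup x l) (entry-⊗ A B i l)) ⟩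
  sum (λ l → sum (λ m → entry A i m ∧ entry B m l) ∧ lookup x l)
    ≡⟨ sum-cong-≗ (λ l → *-distribʳ-sum (lookup x l) (λ m → entry A i m ∧ entry B m l)) ⟩
  sum (λ l → sum (λ m → (entry A i m ∧ entry B m l) ∧ lookup x l))
    ≡⟨ ∑-comm (λ l m → (entry A i m ∧ entry B m l) ∧ lookup x l) ⟩
  sum (λ m → sum (λ l → (entry A i m ∧ entry B m l) ∧ lookup x l))
    ≡⟨ sum-cong-≗ (λ m → sum-cong-≗ (λ l → ∧-assoc (entry A i m) (entry B m l) (lookup x l))) ⟩
  sum (λ m → sum (λ l → entry A i m ∧ (entry B m l ∧ lookup x l)))
    ≡⟨ sum-cong-≗ (λ m → sym (*-distribˡ-sum (entry A i m) (λ l → entry B m l ∧ lookup x l))) ⟩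
  sum (λ m → entry A i m ∧ sum (λ l → entry B m l ∧ lookup x l))
    ≡⟨ sum-cong-≗ (λ m → cong (entry A i m ∧_) (sym (lookup-· B x m))) ⟩
  sum (λ m → entry A i m ∧ lookup (B · x) m)
    ≡⟨ sym (lookup-· A (B · x) i) ⟩
  lookup (A · (B · x)) i
    ∎

idMat-· : (x : V n) → idMat · x ≡ x
idMat-· x = vec-ext λ i → begin
  lookup (idMat · x) i                        ≡⟨ lookup-· idMat x i ⟩
  sum (λ l → entry idMat i l ∧ lookup x l)    ≡⟨ sum-cong-≗ (λ l → cong (_∧ lookup x l) (entry-idMat i l)) ⟩
  sum (λ l → does (i ≟ l) ∧ lookup x l)       ≡⟨ sum-cong-≗ (λ l → ∧-comm (does (i ≟ l)) (lookup x l)) ⟩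
  sum (λ l → lookup x l ∧ does (i ≟ l))       ≡⟨ sum-δ (lookup x) i ⟩
  lookup x i                                  ∎

·-unit : (A : Mat n) (j : Fin n) → A · unit j ≡ lookup (transpose A) j
·-unit A j = vec-ext λ i → begin
  lookup (A · unit j) i                        ≡⟨ lookup-· A (unit j) i ⟩
  sum (λ l → entry A i l ∧ lookup (unit j) l)  ≡⟨ sum-cong-≗ (λ l → cong (entry A i l ∧_) (lookup-unit j l)) ⟩
  sum (λ l → entry A i l ∧ does (j ≟ l))       ≡⟨ sum-δ (entry A i) j ⟩
  entry A i j                                  ≡⟨ sym (entry-transpose A j i) ⟩
  entry (transpose A) j i                      ∎

·-unit-ext : (A B : Mat n) → (∀ j → A · unit j ≡ B · unit j) → A ≡ B
·-unit-ext A B p = begin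
  A                          ≡⟨ sym (transpose-involutive A) ⟩
  transpose (transpose A)    ≡⟨ cong transpose (vec-ext λ j → trans (sym (·-unit A j)) (trans (p j) (·-unit B j))) ⟩
  transpose (transpose B)    ≡⟨ transpose-involutive B ⟩
  B                          ∎

·-ext : (A B : Mat n) → (∀ x → A · x ≡ B · x) → A ≡ B
·-ext A B p = ·-unit-ext A B (p ∘ unit)

transpose-·-unit : (M : Mat n) (j : Fin n) → transpose M · unit j ≡ lookup M j
transpose-·-unit M j = trans (·-unit (transpose M) j) (cong (λ A → lookup A j) (transpose-involutive M))

⊕-assoc : (x y z : V n) → (x ⊕ y) ⊕ z ≡ x ⊕ (y ⊕ z)
⊕-assoc = zipWith-assoc xor-assoc

⊕-identityˡ : (x : V n) → zeroV ⊕ x ≡ x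
⊕-identityˡ = zipWith-identityˡ xor-identityˡ

⊕-identityʳ : (x : V n) → x ⊕ zeroV ≡ x
⊕-identityʳ = zipWith-identityʳ xor-identityʳ

⊕-self : (x : V n) → x ⊕ x ≡ zeroV
⊕-self []      = refl
⊕-self (a ∷ x) = cong₂ _∷_ (xor-same a) (⊕-self x)

⊕-cancelʳ : (x y : V n) → (x ⊕ y) ⊕ y ≡ x
⊕-cancelʳ x y = trans (⊕-assoc x y y) (trans (cong (x ⊕_) (⊕-self y)) (⊕-identityʳ x))

·-distrib-⊕ : (A : Mat n) (x y : V n) → A · (x ⊕ y) ≡ (A · x) ⊕ (A · y)
·-distrib-⊕ A x y = vec-ext λ i → begin
  lookup (A · (x ⊕ y)) i
    ≡⟨ lookup-· A (x ⊕ y) i ⟩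
  sum (λ l → entry A i l ∧ lookup (x ⊕ y) l)
    ≡⟨ sum-cong-≗ (λ l → trans (cong (entry A i l ∧_) (lookup-zipWith _ l x y))
                               (∧-distribˡ-xor (entry A i l) (lookup x l) (lookup y l))) ⟩
  sum (λ l → (entry A i l ∧ lookup x l) xor (entry A i l ∧ lookup y l))
    ≡⟨ ∑-distrib-+ (λ l → entry A i l ∧ lookup x l) (λ l → entry A i l ∧ lookup y l) ⟩
  sum (λ l → entry A i l ∧ lookup x l) xor sum (λ l → entry A i l ∧ lookup y l)
    ≡⟨ sym (cong₂ _xor_ (lookup-· A x i) (lookup-· A y i)) ⟩
  lookup (A · x) i xor lookup (A · y) i
    ≡⟨ sym (lookup-zipWith _ i (A · x) (A · y)) ⟩
  lookup ((A · x) ⊕ (A · y)) i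
    ∎

·-zero : (A : Mat n) → A · zeroV ≡ zeroV
·-zero A = begin
  A · zeroV                    ≡⟨ cong (A ·_) (sym (⊕-self zeroV)) ⟩
  A · (zeroV ⊕ zeroV)          ≡⟨ ·-distrib-⊕ A zeroV zeroV ⟩
  (A · zeroV) ⊕ (A · zeroV)    ≡⟨ ⊕-self (A · zeroV) ⟩
  zeroV                        ∎

⊗≡idMat⇒·-cancel : {A B : Mat n} → A ⊗ B ≡ idMat → ∀ x → A · (B · x) ≡ x
⊗≡idMat⇒·-cancel {A = A} {B} AB≡I x = trans (sym (·-assoc A B x)) (trans (cong (_· x) AB≡I) (idMat-· x))

·-cancel⇒⊗≡idMat : {A B : Mat n} → (∀ x → A · (B · x) ≡ x) → A ⊗ B ≡ idMat
·-cancel⇒⊗≡idMat {A = A} {B} p = ·-ext (A ⊗ B) idMat λ x → trans (·-assoc A B x) (trans (p x) (sym (idMat-· x)))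

Invertible-idMat : Invertible (idMat {n})
Invertible-idMat = idMat , I⊗I≡I , I⊗I≡I
  where I⊗I≡I = ·-cancel⇒⊗≡idMat (λ x → trans (idMat-· _) (idMat-· x))

Invertible-⊗ : {A B : Mat n} → Invertible A → Invertible B → Invertible (A ⊗ B)
Invertible-⊗ {A = A} {B} (A⁻¹ , AA⁻¹ , A⁻¹A) (B⁻¹ , BB⁻¹ , B⁻¹B) = B⁻¹ ⊗ A⁻¹ ,
  ·-cancel⇒⊗≡idMat (λ x → begin
    (A ⊗ B) · ((B⁻¹ ⊗ A⁻¹) · x)   ≡⟨ cong₂ _·_ refl (·-assoc B⁻¹ A⁻¹ x) ⟩
    (A ⊗ B) · (B⁻¹ · (A⁻¹ · x))   ≡⟨ ·-assoc A B _ ⟩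
    A · (B · (B⁻¹ · (A⁻¹ · x)))   ≡⟨ cong (A ·_) (⊗≡idMat⇒·-cancel BB⁻¹ (A⁻¹ · x)) ⟩
    A · (A⁻¹ · x)                 ≡⟨ ⊗≡idMat⇒·-cancel AA⁻¹ x ⟩
    x                             ∎) ,
  ·-cancel⇒⊗≡idMat (λ x → begin
    (B⁻¹ ⊗ A⁻¹) · ((A ⊗ B) · x)   ≡⟨ cong₂ _·_ refl (·-assoc A B x) ⟩
    (B⁻¹ ⊗ A⁻¹) · (A · (B · x))   ≡⟨ ·-assoc B⁻¹ A⁻¹ _ ⟩
    B⁻¹ · (A⁻¹ · (A · (B · x)))   ≡⟨ cong (B⁻¹ ·_) (⊗≡idMat⇒·-cancel A⁻¹A (B · x)) ⟩
    B⁻¹ · (B · x)                 ≡⟨ ⊗≡idMat⇒·-cancel B⁻¹B x ⟩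
    x                             ∎)

Invertible-transpose : {A : Mat n} → Invertible A → Invertible (transpose A)
Invertible-transpose {A = A} (A⁻¹ , AA⁻¹ , A⁻¹A) = transpose A⁻¹ ,
  trans (sym (transpose-⊗ A⁻¹ A)) (trans (cong transpose A⁻¹A) transpose-idMat) ,
  trans (sym (transpose-⊗ A A⁻¹)) (trans (cong transpose AA⁻¹) transpose-idMat)

Invertible⇒rows-injective : {M : Mat n} → Invertible M → ∀ {i j} → lookup M i ≡ lookup M j → i ≡ j
Invertible⇒rows-injective {M = M} (M⁻¹ , MM⁻¹ , _) {i} {j} Mi≡Mj = j≡i⇒ (j ≟ i) (begin
  true                          ≡⟨ sym (dec-true (i ≟ i) refl) ⟩
  does (i ≟ i)                  ≡⟨ sym (entry-idMat i i) ⟩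
  entry idMat i i               ≡⟨ cong (λ A → entry A i i) (sym MM⁻¹) ⟩
  entry (M ⊗ M⁻¹) i i           ≡⟨ cong (λ r → lookup r i) same-rows ⟩
  entry (M ⊗ M⁻¹) j i           ≡⟨ cong (λ A → entry A j i) MM⁻¹ ⟩
  entry idMat j i               ≡⟨ entry-idMat j i ⟩
  does (j ≟ i)                  ∎)
  where
  same-rows : lookup (M ⊗ M⁻¹) i ≡ lookup (M ⊗ M⁻¹) j
  same-rows = trans (lookup-map i _ M) (trans (cong (λ r → map (dot r) (transpose M⁻¹)) Mi≡Mj) (sym (lookup-map j _ M)))
  j≡i⇒ : (d : Dec (j ≡ i)) → true ≡ does d → i ≡ j
  j≡i⇒ (yes j≡i) _ = sym j≡i
  j≡i⇒ (no _) ()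

-- The cyclic shift

cyclicPred : Fin (suc m) → Fin (suc m)
cyclicPred zero    = fromℕ _
cyclicPred (suc i) = inject₁ i

cyclicPred^ : ℕ → Fin (suc m) → Fin (suc m)
cyclicPred^ zero    i = i
cyclicPred^ (suc p) i = cyclicPred^ p (cyclicPred i)

cyclicPred^-+ : ∀ a b (i : Fin (suc m)) → cyclicPred^ (a + b) i ≡ cyclicPred^ b (cyclicPred^ a i)
cyclicPred^-+ zero    b i = refl
cyclicPred^-+ (suc a) b i = cyclicPred^-+ a b (cyclicPred i)

cyclicPred^-no-wrap : ∀ p (j i : Fin (suc m)) → toℕ i + p ≡ toℕ j → cyclicPred^ p j ≡ i
cyclicPred^-no-wrap zero    j       i eq = toℕ-injective (trans (sym eq) (+-identityʳ (toℕ i)))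
cyclicPred^-no-wrap (suc p) zero    i eq = ⊥-elim (1+n≢0 (trans (sym (+-suc (toℕ i) p)) eq))
cyclicPred^-no-wrap (suc p) (suc j) i eq = cyclicPred^-no-wrap p (inject₁ j) i
  (trans (ℕ.suc-injective (trans (sym (+-suc (toℕ i) p)) eq)) (sym (toℕ-inject₁ j)))

cyclicPred^-period : (i : Fin (suc m)) → cyclicPred^ (suc m) i ≡ i
cyclicPred^-period {m} i = begin
  cyclicPred^ (suc m) i
    ≡⟨ cong (λ p → cyclicPred^ p i) (sym i+[1+m-i]≡1+m) ⟩
  cyclicPred^ (toℕ i + suc (m ∸ toℕ i)) i
    ≡⟨ cyclicPred^-+ (toℕ i) (suc (m ∸ toℕ i)) i ⟩
  cyclicPred^ (suc (m ∸ toℕ i)) (cyclicPred^ (toℕ i) i)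
    ≡⟨ cong (cyclicPred^ (suc (m ∸ toℕ i))) (cyclicPred^-no-wrap (toℕ i) i zero refl) ⟩
  cyclicPred^ (m ∸ toℕ i) (fromℕ m)
    ≡⟨ cyclicPred^-no-wrap (m ∸ toℕ i) (fromℕ m) i (trans i+[m-i]≡m (sym (toℕ-fromℕ m))) ⟩
  i
    ∎
  where
  i+[m-i]≡m : toℕ i + (m ∸ toℕ i) ≡ m
  i+[m-i]≡m = m+[n∸m]≡n (toℕ≤pred[n] i)
  i+[1+m-i]≡1+m : toℕ i + suc (m ∸ toℕ i) ≡ suc m
  i+[1+m-i]≡1+m = trans (+-suc (toℕ i) (m ∸ toℕ i)) (cong suc i+[m-i]≡m)

lookup-∷ʳ-fromℕ : (xs : V m) (a : Bool) → lookup (xs ∷ʳ a) (fromℕ m) ≡ a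
lookup-∷ʳ-fromℕ []       a = refl
lookup-∷ʳ-fromℕ (_ ∷ xs) a = lookup-∷ʳ-fromℕ xs a

lookup-∷ʳ-inject₁ : (xs : V m) (a : Bool) (i : Fin m) → lookup (xs ∷ʳ a) (inject₁ i) ≡ lookup xs i
lookup-∷ʳ-inject₁ (_ ∷ xs) a zero    = refl
lookup-∷ʳ-inject₁ (_ ∷ xs) a (suc i) = lookup-∷ʳ-inject₁ xs a i

x≡init∷ʳlast : (x : V (suc m)) → x ≡ init x ∷ʳ last x
x≡init∷ʳlast x = proj₂ (proj₂ (initLast x))

lookup-S : (x : V (suc m)) (i : Fin (suc m)) → lookup (S x) i ≡ lookup x (cyclicPred i)
lookup-S x zero    = sym (trans (cong (λ v → lookup v (fromℕ _)) (x≡init∷ʳlast x))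
                                (lookup-∷ʳ-fromℕ (init x) (last x)))
lookup-S x (suc i) = sym (trans (cong (λ v → lookup v (inject₁ i)) (x≡init∷ʳlast x))
                                (lookup-∷ʳ-inject₁ (init x) (last x) i))

lookup-Sʳ : ∀ p (x : V (suc m)) (i : Fin (suc m)) → lookup (Sʳ p x) i ≡ lookup x (cyclicPred^ p i)
lookup-Sʳ zero    x i = refl
lookup-Sʳ (suc p) x i = trans (lookup-S (Sʳ p x) i) (lookup-Sʳ p x (cyclicPred i))

Sʳ-+ : ∀ a b (x : V n) → Sʳ (a + b) x ≡ Sʳ a (Sʳ b x)
Sʳ-+ zero    b x = refl
Sʳ-+ (suc a) b x = cong S (Sʳ-+ a b x)

Sʳ-fixed-* : ∀ k q {x : V n} → Sʳ k x ≡ x → Sʳ (q * k) x ≡ x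
Sʳ-fixed-* k zero    fixed = refl
Sʳ-fixed-* k (suc q) {x} fixed = trans (Sʳ-+ k (q * k) x) (trans (cong (Sʳ k) (Sʳ-fixed-* k q fixed)) fixed)

Sʳ-period : (x : V (suc m)) → Sʳ (suc m) x ≡ x
Sʳ-period {m} x = vec-ext λ i → trans (lookup-Sʳ (suc m) x i) (cong (lookup x) (cyclicPred^-period i))

Sʳ-multiple-period : ∀ q (x : V (suc m)) → Sʳ (q * suc m) x ≡ x
Sʳ-multiple-period q x = Sʳ-fixed-* _ q (Sʳ-period x)

Sʳ-⊕ : ∀ p (x y : V (suc m)) → Sʳ p (x ⊕ y) ≡ Sʳ p x ⊕ Sʳ p y
Sʳ-⊕ p x y = vec-ext λ i → begin
  lookup (Sʳ p (x ⊕ y)) i                          ≡⟨ lookup-Sʳ p (x ⊕ y) i ⟩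
  lookup (x ⊕ y) (cyclicPred^ p i)                 ≡⟨ lookup-zipWith _ _ x y ⟩
  lookup x (cyclicPred^ p i) xor lookup y (cyclicPred^ p i)
    ≡⟨ sym (cong₂ _xor_ (lookup-Sʳ p x i) (lookup-Sʳ p y i)) ⟩
  lookup (Sʳ p x) i xor lookup (Sʳ p y) i          ≡⟨ sym (lookup-zipWith _ i (Sʳ p x) (Sʳ p y)) ⟩
  lookup (Sʳ p x ⊕ Sʳ p y) i                       ∎

Sʳ-replicate : ∀ p (b : Bool) → Sʳ p (replicate (suc m) b) ≡ replicate (suc m) b
Sʳ-replicate p b = vec-ext λ i →
  trans (lookup-Sʳ p _ i) (trans (lookup-replicate (cyclicPred^ p i) b) (sym (lookup-replicate i b)))

S-unit : {j j′ : Fin (suc m)} → (∀ i → (j ≡ cyclicPred i) ⇔ (j′ ≡ i)) → S (unit j) ≡ unit j′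
S-unit {j = j} {j′} j⇔j′ = vec-ext λ i → begin
  lookup (S (unit j)) i           ≡⟨ lookup-S (unit j) i ⟩
  lookup (unit j) (cyclicPred i)  ≡⟨ lookup-unit j (cyclicPred i) ⟩
  does (j ≟ cyclicPred i)         ≡⟨ does-⇔ (j⇔j′ i) (j ≟ cyclicPred i) (j′ ≟ i) ⟩
  does (j′ ≟ i)                   ≡⟨ sym (lookup-unit j′ i) ⟩
  lookup (unit j′) i              ∎

S-unit-inject₁ : (j : Fin m) → S (unit (inject₁ j)) ≡ unit (suc j)
S-unit-inject₁ j = S-unit {j = inject₁ j} λ where
  zero    → mk⇔ (λ e → ⊥-elim (fromℕ≢inject₁ (sym e))) (λ ())
  (suc i) → mk⇔ (λ e → cong suc (inject₁-injective e)) (λ e → cong inject₁ (suc-injective e))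

S-unit-fromℕ : S (unit (fromℕ m)) ≡ unit zero
S-unit-fromℕ = S-unit λ where
  zero    → mk⇔ (λ _ → refl) (λ _ → refl)
  (suc i) → mk⇔ (λ e → ⊥-elim (fromℕ≢inject₁ e)) (λ ())

shiftMatrix : ℕ → Mat (suc m)
shiftMatrix p = tabulate (λ i → unit (cyclicPred^ p i))

Sʳ-as-· : ∀ p (x : V (suc m)) → Sʳ p x ≡ shiftMatrix p · x
Sʳ-as-· p x = vec-ext λ i → begin
  lookup (Sʳ p x) i                                      ≡⟨ lookup-Sʳ p x i ⟩
  lookup x (cyclicPred^ p i)                             ≡⟨ sym (sum-δ (lookup x) (cyclicPred^ p i)) ⟩
  sum (λ l → lookup x l ∧ does (cyclicPred^ p i ≟ l))    ≡⟨ sum-cong-≗ (λ l → trans (∧-comm (lookup x l) _)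
                                                              (cong (_∧ lookup x l) (sym (entry-shiftMatrix i l)))) ⟩
  sum (λ l → entry (shiftMatrix p) i l ∧ lookup x l)     ≡⟨ sym (lookup-· (shiftMatrix p) x i) ⟩
  lookup (shiftMatrix p · x) i                           ∎
  where
  entry-shiftMatrix : ∀ i l → entry (shiftMatrix p) i l ≡ does (cyclicPred^ p i ≟ l)
  entry-shiftMatrix i l = trans (cong (λ r → lookup r l) (lookup∘tabulate (λ i → unit (cyclicPred^ p i)) i))
                                (lookup-unit (cyclicPred^ p i) l)

·-intertwines-S : ∀ k (A : Mat (suc m)) → (∀ j → A · S (unit j) ≡ Sʳ k (A · unit j)) →
                  ∀ x → A · S x ≡ Sʳ k (A · x)
·-intertwines-S k A on-units x = begin
  A · S x                    ≡⟨ cong (A ·_) (Sʳ-as-· 1 x) ⟩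
  A · (shiftMatrix 1 · x)    ≡⟨ sym (·-assoc A (shiftMatrix 1) x) ⟩
  (A ⊗ shiftMatrix 1) · x    ≡⟨ cong (_· x) A⊗S≡Sᵏ⊗A ⟩
  (shiftMatrix k ⊗ A) · x    ≡⟨ ·-assoc (shiftMatrix k) A x ⟩
  shiftMatrix k · (A · x)    ≡⟨ sym (Sʳ-as-· k (A · x)) ⟩
  Sʳ k (A · x)               ∎
  where
  A⊗S≡Sᵏ⊗A : A ⊗ shiftMatrix 1 ≡ shiftMatrix k ⊗ A
  A⊗S≡Sᵏ⊗A = ·-unit-ext _ _ λ j → begin
    (A ⊗ shiftMatrix 1) · unit j    ≡⟨ ·-assoc A (shiftMatrix 1) (unit j) ⟩
    A · (shiftMatrix 1 · unit j)    ≡⟨ cong (A ·_) (sym (Sʳ-as-· 1 (unit j))) ⟩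
    A · S (unit j)                  ≡⟨ on-units j ⟩
    Sʳ k (A · unit j)               ≡⟨ Sʳ-as-· k (A · unit j) ⟩
    shiftMatrix k · (A · unit j)    ≡⟨ sym (·-assoc (shiftMatrix k) A (unit j)) ⟩
    (shiftMatrix k ⊗ A) · unit j    ∎

-- Circulant matrices

circulant : ℕ → V n → Mat n
circulant k r = tabulate (λ i → Sʳ (toℕ i * k) r)

circulant-Circulant : ∀ k (r : V n) → Circulant k (circulant k r)
circulant-Circulant k r = r , lookup∘tabulate (λ i → Sʳ (toℕ i * k) r)

Circulant⇒≡circulant : ∀ {k} {M : Mat (suc m)} → Circulant k M → M ≡ circulant k (lookup M zero)
Circulant⇒≡circulant {k = k} {M} (r , rows) = vec-ext λ i → begin
  lookup M i                                    ≡⟨ rows i ⟩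
  Sʳ (toℕ i * k) r                              ≡⟨ cong (Sʳ (toℕ i * k)) (sym (rows zero)) ⟩
  Sʳ (toℕ i * k) (lookup M zero)                ≡⟨ sym (lookup∘tabulate (λ i → Sʳ (toℕ i * k) (lookup M zero)) i) ⟩
  lookup (circulant k (lookup M zero)) i        ∎

Circulant-step : ∀ {k} {M : Mat (suc m)} → Circulant k M →
                 ∀ (j : Fin m) → lookup M (suc j) ≡ Sʳ k (lookup M (inject₁ j))
Circulant-step {k = k} {M} (r , rows) j = begin
  lookup M (suc j)                       ≡⟨ rows (suc j) ⟩
  Sʳ (k + toℕ j * k) r                   ≡⟨ Sʳ-+ k (toℕ j * k) r ⟩
  Sʳ k (Sʳ (toℕ j * k) r)                ≡⟨ cong (λ t → Sʳ k (Sʳ (t * k) r)) (sym (toℕ-inject₁ j)) ⟩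
  Sʳ k (Sʳ (toℕ (inject₁ j) * k) r)      ≡⟨ cong (Sʳ k) (sym (rows (inject₁ j))) ⟩
  Sʳ k (lookup M (inject₁ j))            ∎

Circulant-wrap : ∀ {k} {M : Mat (suc m)} → Circulant k M → lookup M zero ≡ Sʳ k (lookup M (fromℕ m))
Circulant-wrap {m} {k} {M} (r , rows) = sym (begin
  Sʳ k (lookup M (fromℕ m))              ≡⟨ cong (Sʳ k) (rows (fromℕ m)) ⟩
  Sʳ k (Sʳ (toℕ (fromℕ m) * k) r)        ≡⟨ cong (λ t → Sʳ k (Sʳ (t * k) r)) (toℕ-fromℕ m) ⟩
  Sʳ k (Sʳ (m * k) r)                    ≡⟨ sym (Sʳ-+ k (m * k) r) ⟩
  Sʳ (suc m * k) r                       ≡⟨ cong (λ t → Sʳ t r) (*-comm (suc m) k) ⟩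
  Sʳ (k * suc m) r                       ≡⟨ Sʳ-multiple-period k r ⟩
  r                                      ≡⟨ sym (rows zero) ⟩
  lookup M zero                          ∎)

step⇒Circulant : ∀ {k} {M : Mat (suc m)} →
                 (∀ (j : Fin m) → lookup M (suc j) ≡ Sʳ k (lookup M (inject₁ j))) → Circulant k M
step⇒Circulant {k = k} {M} step = lookup M zero , λ i → rows (toℕ i) i refl
  where
  rows : ∀ t i → toℕ i ≡ t → lookup M i ≡ Sʳ (t * k) (lookup M zero)
  rows zero    zero    _  = refl
  rows (suc t) (suc j) eq = begin
    lookup M (suc j)                       ≡⟨ step j ⟩
    Sʳ k (lookup M (inject₁ j))
      ≡⟨ cong (Sʳ k) (rows t (inject₁ j) (trans (toℕ-inject₁ j) (ℕ.suc-injective eq))) ⟩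
    Sʳ k (Sʳ (t * k) (lookup M zero))      ≡⟨ sym (Sʳ-+ k (t * k) _) ⟩
    Sʳ (suc t * k) (lookup M zero)         ∎

inject₁-or-fromℕ : (j : Fin (suc m)) → (∃ λ j′ → j ≡ inject₁ j′) ⊎ j ≡ fromℕ m
inject₁-or-fromℕ {zero}  zero    = inj₂ refl
inject₁-or-fromℕ {suc m} zero    = inj₁ (zero , refl)
inject₁-or-fromℕ {suc m} (suc j) with inject₁-or-fromℕ j
... | inj₁ (j′ , eq) = inj₁ (suc j′ , cong suc eq)
... | inj₂ eq        = inj₂ (cong suc eq)

Circulant⇒transpose-intertwines-S : ∀ {k} {M : Mat (suc m)} → Circulant k M →
                                    ∀ x → transpose M · S x ≡ Sʳ k (transpose M · x)
Circulant⇒transpose-intertwines-S {k = k} {M} circ = ·-intertwines-S k (transpose M) on-units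
  where
  on-units : ∀ j → transpose M · S (unit j) ≡ Sʳ k (transpose M · unit j)
  on-units j with inject₁-or-fromℕ j
  ... | inj₁ (j′ , refl) = begin
    transpose M · S (unit (inject₁ j′))   ≡⟨ cong (transpose M ·_) (S-unit-inject₁ j′) ⟩
    transpose M · unit (suc j′)           ≡⟨ transpose-·-unit M (suc j′) ⟩
    lookup M (suc j′)                     ≡⟨ Circulant-step {M = M} circ j′ ⟩
    Sʳ k (lookup M (inject₁ j′))          ≡⟨ cong (Sʳ k) (sym (transpose-·-unit M (inject₁ j′))) ⟩
    Sʳ k (transpose M · unit (inject₁ j′)) ∎
  ... | inj₂ refl = begin
    transpose M · S (unit (fromℕ _))      ≡⟨ cong (transpose M ·_) S-unit-fromℕ ⟩
    transpose M · unit zero               ≡⟨ transpose-·-unit M zero ⟩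
    lookup M zero                         ≡⟨ Circulant-wrap {M = M} circ ⟩
    Sʳ k (lookup M (fromℕ _))             ≡⟨ cong (Sʳ k) (sym (transpose-·-unit M (fromℕ _))) ⟩
    Sʳ k (transpose M · unit (fromℕ _))   ∎

Invertible-Circulant⇒Coprime : ∀ {k} {M : Mat (suc m)} → Invertible M → Circulant k M → Coprime k (suc m)
Invertible-Circulant⇒Coprime {m} {k} {M} inv (r , rows) {d} (divides p k≡p*d , divides q n≡q*d) = d≡1 d q k≡p*d n≡q*d
  where
  d≡1 : ∀ d q → k ≡ p * d → suc m ≡ q * d → d ≡ 1
  d≡1 zero          q       _     n≡q*0 = ⊥-elim (1+n≢0 (trans n≡q*0 (*-zeroʳ q)))
  d≡1 (suc zero)    q       _     _     = refl
  d≡1 (suc (suc _)) zero    _     ()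
  -- For d ≥ 2 the index q = n / d is a nonzero row index, and row q = S^{qk} r = S^{pn} r = row 0.
  d≡1 d@(suc (suc _)) q@(suc q′) k≡p*d n≡q*d = ⊥-elim (1+n≢0 (begin
    suc q′              ≡⟨ sym (toℕ-fromℕ< q<n) ⟩
    toℕ (fromℕ< q<n)    ≡⟨ cong toℕ (Invertible⇒rows-injective inv row-q≡row-0) ⟩
    0                   ∎))
    where
    q<n : q < suc m
    q<n = subst (q <_) (sym n≡q*d) (m<m*n q d (s≤s (s≤s z≤n)))
    row-q≡row-0 : lookup M (fromℕ< q<n) ≡ lookup M zero
    row-q≡row-0 = begin
      lookup M (fromℕ< q<n)              ≡⟨ rows (fromℕ< q<n) ⟩
      Sʳ (toℕ (fromℕ< q<n) * k) r        ≡⟨ cong (λ t → Sʳ (t * k) r) (toℕ-fromℕ< q<n) ⟩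
      Sʳ (q * k) r                       ≡⟨ cong (λ t → Sʳ t r) (trans (cong (q *_) k≡p*d) (x∙yz≈y∙xz q p d)) ⟩
      Sʳ (p * (q * d)) r                 ≡⟨ cong (λ t → Sʳ (p * t) r) (sym n≡q*d) ⟩
      Sʳ (p * suc m) r                   ≡⟨ Sʳ-multiple-period p r ⟩
      r                                  ≡⟨ sym (rows zero) ⟩
      lookup M zero                      ∎

Sʳ-fixed⇒S-fixed : ∀ {k} → Coprime k (suc m) → {x : V (suc m)} → Sʳ k x ≡ x → S x ≡ x
Sʳ-fixed⇒S-fixed {m} {k} coprime {x} fixed with coprime-Bézout coprime
... | Bézout.+- a b 1+b*n≡a*k = begin
  S x                        ≡⟨ cong S (sym (Sʳ-multiple-period b x)) ⟩
  Sʳ (suc (b * suc m)) x     ≡⟨ cong (λ t → Sʳ t x) 1+b*n≡a*k ⟩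
  Sʳ (a * k) x               ≡⟨ Sʳ-fixed-* k a fixed ⟩
  x                          ∎
... | Bézout.-+ a b 1+a*k≡b*n = begin
  S x                        ≡⟨ cong S (sym (Sʳ-fixed-* k a fixed)) ⟩
  Sʳ (suc (a * k)) x         ≡⟨ cong (λ t → Sʳ t x) 1+a*k≡b*n ⟩
  Sʳ (b * suc m) x           ≡⟨ Sʳ-multiple-period b x ⟩
  x                          ∎

S-fixed⇒constant : {x : V (suc m)} → S x ≡ x → x ≡ replicate (suc m) (lookup x zero)
S-fixed⇒constant {x = x} fixed = vec-ext λ i → trans (≡lookup-zero (toℕ i) i refl) (sym (lookup-replicate i _))
  where
  ≡lookup-zero : ∀ t i → toℕ i ≡ t → lookup x i ≡ lookup x zero
  ≡lookup-zero zero    zero    _  = refl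
  ≡lookup-zero (suc t) (suc j) eq = begin
    lookup x (suc j)         ≡⟨ cong (λ v → lookup v (suc j)) (sym fixed) ⟩
    lookup (S x) (suc j)     ≡⟨ lookup-S x (suc j) ⟩
    lookup x (inject₁ j)     ≡⟨ ≡lookup-zero t (inject₁ j) (trans (toℕ-inject₁ j) (ℕ.suc-injective eq)) ⟩
    lookup x zero            ∎

-- Shift-invariant maps affine equivalent to the identity

InvertibleAffine : (V n → V n) → Set
InvertibleAffine {n} G = Σ (Mat n) λ L → Σ (V n) λ c → Invertible L × (∀ x → G x ≡ (L · x) ⊕ c)

AffEqId⇒InvertibleAffine : {G : V n → V n} → AffEqId G → InvertibleAffine G
AffEqId⇒InvertibleAffine {G = G} (A , B , d , e , invA , (B⁻¹ , BB⁻¹ , B⁻¹B) , Ax+e≡BGx+d) =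
  B⁻¹ ⊗ A , B⁻¹ · (e ⊕ d) , Invertible-⊗ (B , B⁻¹B , BB⁻¹) invA , λ x → begin
    G x                              ≡⟨ sym (⊗≡idMat⇒·-cancel B⁻¹B (G x)) ⟩
    B⁻¹ · (B · G x)                  ≡⟨ cong (B⁻¹ ·_) (sym (⊕-cancelʳ (B · G x) d)) ⟩
    B⁻¹ · (((B · G x) ⊕ d) ⊕ d)      ≡⟨ cong (λ y → B⁻¹ · (y ⊕ d)) (sym (Ax+e≡BGx+d x)) ⟩
    B⁻¹ · (((A · x) ⊕ e) ⊕ d)        ≡⟨ cong (B⁻¹ ·_) (⊕-assoc (A · x) e d) ⟩
    B⁻¹ · ((A · x) ⊕ (e ⊕ d))        ≡⟨ ·-distrib-⊕ B⁻¹ (A · x) (e ⊕ d) ⟩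
    (B⁻¹ · (A · x)) ⊕ (B⁻¹ · (e ⊕ d)) ≡⟨ cong (_⊕ (B⁻¹ · (e ⊕ d))) (sym (·-assoc B⁻¹ A x)) ⟩
    ((B⁻¹ ⊗ A) · x) ⊕ (B⁻¹ · (e ⊕ d)) ∎

InvertibleAffine⇒AffEqId : {G : V n → V n} → InvertibleAffine G → AffEqId G
InvertibleAffine⇒AffEqId {G = G} (L , c , invL , G≡Lx+c) = L , idMat , c , zeroV , invL , Invertible-idMat , λ x → begin
  (L · x) ⊕ zeroV             ≡⟨ ⊕-identityʳ (L · x) ⟩
  L · x                       ≡⟨ sym (⊕-cancelʳ (L · x) c) ⟩
  ((L · x) ⊕ c) ⊕ c           ≡⟨ cong (_⊕ c) (sym (G≡Lx+c x)) ⟩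
  G x ⊕ c                     ≡⟨ cong (_⊕ c) (sym (idMat-· (G x))) ⟩
  (idMat · G x) ⊕ c           ∎

linearPart : (V n → V n) → Mat n
linearPart G = tabulate (λ j → G (unit j) ⊕ G zeroV)

lookup-linearPart : (G : V n → V n) (j : Fin n) → lookup (linearPart G) j ≡ G (unit j) ⊕ G zeroV
lookup-linearPart G = lookup∘tabulate (λ j → G (unit j) ⊕ G zeroV)

linearPart-cong : {G H : V n → V n} → (∀ x → G x ≡ H x) → linearPart G ≡ linearPart H
linearPart-cong G≗H = tabulate-cong (λ j → cong₂ _⊕_ (G≗H (unit j)) (G≗H zeroV))

linearPart-affine : {G : V n → V n} (L : Mat n) (c : V n) → (∀ x → G x ≡ (L · x) ⊕ c) → linearPart G ≡ transpose L
linearPart-affine {G = G} L c G≡Lx+c = vec-ext λ j → begin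
  lookup (linearPart G) j                   ≡⟨ lookup-linearPart G j ⟩
  G (unit j) ⊕ G zeroV                      ≡⟨ cong₂ _⊕_ (G≡Lx+c (unit j)) (G≡Lx+c zeroV) ⟩
  ((L · unit j) ⊕ c) ⊕ ((L · zeroV) ⊕ c)    ≡⟨ cong (λ y → ((L · unit j) ⊕ c) ⊕ (y ⊕ c)) (·-zero L) ⟩
  ((L · unit j) ⊕ c) ⊕ (zeroV ⊕ c)          ≡⟨ cong (((L · unit j) ⊕ c) ⊕_) (⊕-identityˡ c) ⟩
  ((L · unit j) ⊕ c) ⊕ c                    ≡⟨ ⊕-cancelʳ (L · unit j) c ⟩
  L · unit j                                ≡⟨ ·-unit L j ⟩
  lookup (transpose L) j                    ∎

InvertibleAffine⇒Invertible-linearPart : {G : V n → V n} → InvertibleAffine G → Invertible (linearPart G)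
InvertibleAffine⇒Invertible-linearPart (L , c , invL , G≡Lx+c) =
  subst Invertible (sym (linearPart-affine L c G≡Lx+c)) (Invertible-transpose invL)

S-zeroV : S (zeroV {suc m}) ≡ zeroV
S-zeroV = Sʳ-replicate 1 false

ShiftInvariant⇒G0-Sʳ-fixed : ∀ {k} {G : V (suc m) → V (suc m)} → ShiftInvariant k G → Sʳ k (G zeroV) ≡ G zeroV
ShiftInvariant⇒G0-Sʳ-fixed {G = G} inv = trans (sym (inv zeroV)) (cong G S-zeroV)

ShiftInvariant⇒Circulant : ∀ {k} {G : V (suc m) → V (suc m)} → ShiftInvariant k G → Circulant k (linearPart G)
ShiftInvariant⇒Circulant {k = k} {G} inv = step⇒Circulant {M = linearPart G} λ j → begin
  lookup (linearPart G) (suc j)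
    ≡⟨ lookup-linearPart G (suc j) ⟩
  G (unit (suc j)) ⊕ G zeroV
    ≡⟨ cong₂ _⊕_ (cong G (sym (S-unit-inject₁ j))) (sym (ShiftInvariant⇒G0-Sʳ-fixed {k = k} {G = G} inv)) ⟩
  G (S (unit (inject₁ j))) ⊕ Sʳ k (G zeroV)
    ≡⟨ cong (_⊕ Sʳ k (G zeroV)) (inv (unit (inject₁ j))) ⟩
  Sʳ k (G (unit (inject₁ j))) ⊕ Sʳ k (G zeroV)
    ≡⟨ sym (Sʳ-⊕ k _ _) ⟩
  Sʳ k (G (unit (inject₁ j)) ⊕ G zeroV)
    ≡⟨ cong (Sʳ k) (sym (lookup-linearPart G (inject₁ j))) ⟩
  Sʳ k (lookup (linearPart G) (inject₁ j))
    ∎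

affineMap : Bool → Mat n → V n → V n
affineMap {n} b M x = (transpose M · x) ⊕ replicate n b

affineMap-InvertibleAffine : ∀ b {M : Mat n} → Invertible M → InvertibleAffine (affineMap b M)
affineMap-InvertibleAffine {n} b {M} invM = transpose M , replicate n b , Invertible-transpose invM , λ x → refl

affineMap-ShiftInvariant : ∀ {k} b {M : Mat (suc m)} → Circulant k M → ShiftInvariant k (affineMap b M)
affineMap-ShiftInvariant {m} {k} b {M} circ x = begin
  (transpose M · S x) ⊕ replicate (suc m) b
    ≡⟨ cong₂ _⊕_ (Circulant⇒transpose-intertwines-S circ x) (sym (Sʳ-replicate k b)) ⟩
  Sʳ k (transpose M · x) ⊕ Sʳ k (replicate (suc m) b)
    ≡⟨ sym (Sʳ-⊕ k _ _) ⟩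
  Sʳ k ((transpose M · x) ⊕ replicate (suc m) b)
    ∎

linearPart-affineMap : ∀ b (M : Mat n) → linearPart (affineMap b M) ≡ M
linearPart-affineMap {n} b M = trans (linearPart-affine (transpose M) (replicate n b) (λ x → refl)) (transpose-involutive M)

lookup-affineMap-zeroV : ∀ b (M : Mat (suc m)) → lookup (affineMap b M zeroV) zero ≡ b
lookup-affineMap-zeroV b M = cong (λ y → lookup (y ⊕ replicate _ b) zero) (·-zero (transpose M))

ShiftInvariant-InvertibleAffine⇒affineMap :
  ∀ {k} {G : V (suc m) → V (suc m)} → ShiftInvariant k G → InvertibleAffine G →
  ∀ x → G x ≡ affineMap (lookup (G zeroV) zero) (linearPart G) x
ShiftInvariant-InvertibleAffine⇒affineMap {m} {k} {G} inv aff@(L , c , _ , G≡Lx+c) x = begin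
  G x
    ≡⟨ G≡Lx+c x ⟩
  (L · x) ⊕ c
    ≡⟨ cong₂ _⊕_ (cong (_· x) (sym linearPartᵀ≡L)) c-constant ⟩
  (transpose (linearPart G) · x) ⊕ replicate (suc m) (lookup (G zeroV) zero)
    ∎
  where
  linearPartᵀ≡L : transpose (linearPart G) ≡ L
  linearPartᵀ≡L = trans (cong transpose (linearPart-affine L c G≡Lx+c)) (transpose-involutive L)
  G0≡c : G zeroV ≡ c
  G0≡c = trans (G≡Lx+c zeroV) (trans (cong (_⊕ c) (·-zero L)) (⊕-identityˡ c))
  coprime : Coprime k (suc m)
  coprime = Invertible-Circulant⇒Coprime (InvertibleAffine⇒Invertible-linearPart aff)
                                         (ShiftInvariant⇒Circulant {k = k} {G = G} inv)
  c-constant : c ≡ replicate (suc m) (lookup (G zeroV) zero)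
  c-constant = trans (sym G0≡c)
    (S-fixed⇒constant (Sʳ-fixed⇒S-fixed coprime (ShiftInvariant⇒G0-Sʳ-fixed {k = k} {G = G} inv)))

ShiftInvAffId↔Bool×InvCirc : ∀ m k →
                             Inverse (ShiftInvAffIdSetoid (suc m) k) (≡.setoid Bool ×ₛ InvCircSetoid (suc m) k)
ShiftInvAffId↔Bool×InvCirc m k = strictInverse to from
  (λ G≗H → cong (λ y → lookup y zero) (G≗H zeroV) , linearPart-cong G≗H)
  (λ { (refl , refl) x → refl })
  to∘from from∘to
  where
  open Setoid (ShiftInvAffIdSetoid (suc m) k) using () renaming (Carrier to Maps; _≈_ to _≈ᴳ_)
  open Setoid (≡.setoid Bool ×ₛ InvCircSetoid (suc m) k) using () renaming (Carrier to Pairs; _≈_ to _≈ᴾ_)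

  to : Maps → Pairs
  to (G , inv , aff) = lookup (G zeroV) zero , linearPart G ,
    InvertibleAffine⇒Invertible-linearPart (AffEqId⇒InvertibleAffine aff) , ShiftInvariant⇒Circulant {k = k} {G = G} inv

  from : Pairs → Maps
  from (b , M , invM , circ) = affineMap b M , affineMap-ShiftInvariant {k = k} b {M} circ ,
    InvertibleAffine⇒AffEqId (affineMap-InvertibleAffine b invM)

  to∘from : ∀ p → to (from p) ≈ᴾ p
  to∘from (b , M , _) = lookup-affineMap-zeroV b M , linearPart-affineMap b M

  from∘to : ∀ G → from (to G) ≈ᴳ G
  from∘to (G , inv , aff) x =
    sym (ShiftInvariant-InvertibleAffine⇒affineMap {k = k} {G = G} inv (AffEqId⇒InvertibleAffine aff) x)

-- Counting

HasCard-Bool : HasCard (≡.setoid Bool) 2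
HasCard-Bool = Inv.sym 2↔Bool

HasCard-×ₛ : ∀ {X Y : Setoid 0ℓ 0ℓ} {a b} → HasCard X a → HasCard Y b → HasCard (X ×ₛ Y) (a * b)
HasCard-×ₛ X↔a Y↔b = Inv.trans (X↔a ×-inverse Y↔b) (Inv.trans ×ᴾ.Pointwise-≡↔≡ (Inv.sym *↔×))

SubsetSetoid : (V n → Set) → Setoid 0ℓ 0ℓ
SubsetSetoid {n} P = On.setoid {B = Σ (V n) P} (≡.setoid (V n)) proj₁

SubsetSetoid-split : (P : V (suc n) → Set) →
                     Inverse (SubsetSetoid P) (SubsetSetoid (P ∘ (false ∷_)) ⊎ₛ SubsetSetoid (P ∘ (true ∷_)))
SubsetSetoid-split {n} P = strictInverse to from
  (λ { {false ∷ _ , _} refl → ⊎ᴾ.inj₁ refl ; {true ∷ _ , _} refl → ⊎ᴾ.inj₂ refl })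
  (λ { (⊎ᴾ.inj₁ refl) → refl ; (⊎ᴾ.inj₂ refl) → refl })
  (λ { (inj₁ _) → ⊎ᴾ.inj₁ refl ; (inj₂ _) → ⊎ᴾ.inj₂ refl })
  (λ { (false ∷ _ , _) → refl ; (true ∷ _ , _) → refl })
  where
  to : Σ (V (suc n)) P → Σ (V n) (P ∘ (false ∷_)) ⊎ Σ (V n) (P ∘ (true ∷_))
  to (false ∷ v , p) = inj₁ (v , p)
  to (true  ∷ v , p) = inj₂ (v , p)
  from : Σ (V n) (P ∘ (false ∷_)) ⊎ Σ (V n) (P ∘ (true ∷_)) → Σ (V (suc n)) P
  from (inj₁ (v , p)) = false ∷ v , p
  from (inj₂ (v , p)) = true ∷ v , p

SubsetSetoid-finite : {P : V n → Set} → (∀ v → Dec (P v)) → Σ ℕ (HasCard (SubsetSetoid P))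
SubsetSetoid-finite {zero} {P} P? with P? []
... | yes p = 1 , strictInverse (λ _ → zero) (λ _ → [] , p) (λ _ → refl) (λ _ → refl)
                    (λ { zero → refl }) (λ { ([] , _) → refl })
... | no ¬p = 0 , strictInverse (λ { ([] , p) → ⊥-elim (¬p p) }) (λ ())
                    (λ { {[] , p} → ⊥-elim (¬p p) }) (λ { {()} })
                    (λ ()) (λ { ([] , p) → ⊥-elim (¬p p) })
SubsetSetoid-finite {suc n} {P} P? with SubsetSetoid-finite (P? ∘ (false ∷_)) | SubsetSetoid-finite (P? ∘ (true ∷_))
... | a , false-part | b , true-part = a + b ,
  Inv.trans (SubsetSetoid-split P) (Inv.trans (false-part ⊎-inverse true-part)
    (Inv.trans (⊎ᴾ.Pointwise-≡↔≡ (Fin a) (Fin b)) (Inv.sym +↔⊎)))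

Exhaustible : Set → Set₁
Exhaustible A = ∀ {P : A → Set} → (∀ a → Dec (P a)) → Dec (∃ P)

Bool-exhaustible : Exhaustible Bool
Bool-exhaustible P? = map′ (λ { (inj₁ p) → false , p ; (inj₂ p) → true , p })
                           (λ { (false , p) → inj₁ p ; (true , p) → inj₂ p })
                           (P? false ⊎-dec P? true)

Vec-exhaustible : ∀ {A} → Exhaustible A → ∀ n → Exhaustible (Vec A n)
Vec-exhaustible A-ex zero    P? = map′ ([] ,_) (λ { ([] , p) → p }) (P? [])
Vec-exhaustible A-ex (suc n) P? = map′ (λ { (a , v , p) → a ∷ v , p }) (λ { (a ∷ v , p) → a , v , p })
                                        (A-ex (λ a → Vec-exhaustible A-ex n (P? ∘ (a ∷_))))

Invertible? : (M : Mat n) → Dec (Invertible M)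
Invertible? {n} M = Vec-exhaustible (Vec-exhaustible Bool-exhaustible n) n λ B →
  ≡-dec (≡-dec Bool._≟_) (M ⊗ B) idMat ×-dec ≡-dec (≡-dec Bool._≟_) (B ⊗ M) idMat

InvCirc↔invertible-first-rows : ∀ m k →
                                Inverse (InvCircSetoid (suc m) k) (SubsetSetoid (Invertible ∘ circulant {suc m} k))
InvCirc↔invertible-first-rows m k = strictInverse to from
  (cong (λ M → lookup M zero)) (cong (circulant k))
  (λ _ → refl) (λ { (_ , _ , circ) → sym (Circulant⇒≡circulant circ) })
  where
  to : Σ (Mat (suc m)) (λ M → Invertible M × Circulant k M) → Σ (V (suc m)) (Invertible ∘ circulant k)
  to (M , inv , circ) = lookup M zero , subst Invertible (Circulant⇒≡circulant circ) inv
  from : Σ (V (suc m)) (Invertible ∘ circulant k) → Σ (Mat (suc m)) (λ M → Invertible M × Circulant k M)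
  from (r , inv) = circulant k r , inv , circulant-Circulant k r

InvCirc-finite : ∀ m k → Σ ℕ (HasCard (InvCircSetoid (suc m) k))
InvCirc-finite m k = let N , first-rows = SubsetSetoid-finite (Invertible? ∘ circulant k) in
  N , Inv.trans (InvCirc↔invertible-first-rows m k) first-rows

mainTheorem13 : (n k : ℕ) → 1 ≤ k → k ≤ n →
    Σ ℕ (λ N → HasCard (InvCircSetoid n k) N × HasCard (ShiftInvAffIdSetoid n k) (2 * N))
mainTheorem13 zero    k (s≤s z≤n) ()
mainTheorem13 (suc m) k _ _ = let N , InvCirc↔N = InvCirc-finite m k in
  N , InvCirc↔N , Inv.trans (ShiftInvAffId↔Bool×InvCirc m k) (HasCard-×ₛ HasCard-Bool InvCirc↔N)
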